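{- Let $N$ be a directed acyclic graph. Then: (i) $N$ is weakly forest-based if and only if $N$ admits a leaf path partition; (ii) $N$ is forest-based if and only if $N$ admits a leaf induced path partition.
   Context: For a DAG $N$, $V(N)$ and $A(N)$ are its vertex and arc sets; a root is a vertex of indegree $0$ and a leaf is a vertex of outdegree $0$; $L(N)$ is the set of leaves. A tree is a connected (in the underlying undirected sense) DAG with a single root and no vertex of indegree at least $2$; a forest is a DAG every connected component of which is a tree. A DAG $N=(V,A)$ is weakly forest-based if there is $A'\subseteq A$ such that $F'=(V,A')$ is a forest with leaf set $L(N)$; it is forest-based if moreover every arc of $A\setminus A'$ has its two endpoints in different trees of $F'$. A directed path $v_1,\dots,v_k$ is induced if $(v_i,v_j)\notin A(N)$ for all $i\in[k-2]$ and $j\in[k]\setminus\{i,i+1\}$. A path partition of $N$ is a collection of vertex-disjoint directed paths whose union is $V(N)$; it is a leaf path partition if every path ends at a leaf of $N$, and a leaf induced path partition if in addition every path is induced. -}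

module Defs where

open import Data.Nat using (ℕ; zero; suc; _+_; _≤_)
open import Data.Fin using (Fin; toℕ)
open import Data.Bool using (Bool; T)
open import Data.List using (List; concat; map; length; lookup; allFin)
open import Data.List.NonEmpty using (List⁺; toList; last)
open import Data.List.Relation.Unary.All using (All)
open import Data.List.Relation.Unary.Linked using (Linked)
open import Data.List.Relation.Binary.Permutation.Propositional using (_↭_)
open import Data.Product using (Σ; ∃; _×_; _,_)
open import Data.Sum using (_⊎_)
open import Relation.Nullary using (¬_)
open import Relation.Binary.PropositionalEquality using (_≡_; _≢_)
open import Relation.Binary.Construct.Closure.Transitive using (TransClosure)
open import Relation.Binary.Construct.Closure.ReflexiveTransitive using (Star)
open import Function.Bundles using (_⇔_)

Digraph : ℕ → Set
Digraph n = Fin n → Fin n → Bool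

module _ {n : ℕ} where

  Arc : Digraph n → Fin n → Fin n → Set
  Arc A u v = T (A u v)

  Acyclic : Digraph n → Set
  Acyclic A = ∀ v → ¬ TransClosure (Arc A) v v

  IsLeaf : Digraph n → Fin n → Set
  IsLeaf A v = ∀ w → ¬ Arc A v w

  IsRoot : Digraph n → Fin n → Set
  IsRoot A v = ∀ u → ¬ Arc A u v

  Connected : Digraph n → Fin n → Fin n → Set
  Connected A = Star (λ u v → Arc A u v ⊎ Arc A v u)

  -- F is a forest: a DAG each of whose connected components is a tree,
  -- i.e. has exactly one root and no vertex of indegree ≥ 2.
  IsForest : Digraph n → Set
  IsForest F =
    Acyclic F
    × (∀ u w v → Arc F u v → Arc F w v → u ≡ w)
    × (∀ v → ∃ λ r → IsRoot F r × Connected F v r)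
    × (∀ r r' → IsRoot F r → IsRoot F r' → Connected F r r' → r ≡ r')

  SubArcs : Digraph n → Digraph n → Set
  SubArcs F A = ∀ u v → Arc F u v → Arc A u v

  SameLeaves : Digraph n → Digraph n → Set
  SameLeaves F A = ∀ v → (IsLeaf F v ⇔ IsLeaf A v)

  SpanningLeafForest : Digraph n → Digraph n → Set
  SpanningLeafForest A F = SubArcs F A × IsForest F × SameLeaves F A

  WeaklyForestBased : Digraph n → Set
  WeaklyForestBased A = ∃ λ F → SpanningLeafForest A F

  ForestBased : Digraph n → Set
  ForestBased A = ∃ λ F → SpanningLeafForest A F
    × (∀ u v → Arc A u v → ¬ Arc F u v → ¬ Connected F u v)

  IsDirPath : Digraph n → List⁺ (Fin n) → Set
  IsDirPath A p = Linked (Arc A) (toList p)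

  -- induced: (v_i, v_j) ∉ A for i ∈ [k-2], j ∈ [k] ∖ {i, i+1}
  -- (0-based indices: i with i + 3 ≤ k, j ≠ i, j ≠ i + 1)
  IsInduced : Digraph n → List⁺ (Fin n) → Set
  IsInduced A p =
    (i j : Fin (length (toList p))) →
    toℕ i + 3 ≤ length (toList p) →
    toℕ j ≢ toℕ i → toℕ j ≢ suc (toℕ i) →
    ¬ Arc A (lookup (toList p) i) (lookup (toList p) j)

  -- a collection of paths is a path partition iff concatenating them gives
  -- every vertex exactly once (vertex-disjoint and covering V)
  IsPathPartition : Digraph n → List (List⁺ (Fin n)) → Set
  IsPathPartition A P =
    All (IsDirPath A) P × (concat (map toList P) ↭ allFin n)

  IsLeafPathPartition : Digraph n → List (List⁺ (Fin n)) → Set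
  IsLeafPathPartition A P =
    IsPathPartition A P × All (λ p → IsLeaf A (last p)) P

  IsLeafInducedPathPartition : Digraph n → List (List⁺ (Fin n)) → Set
  IsLeafInducedPathPartition A P =
    IsLeafPathPartition A P × All (IsInduced A) P

  HasLeafPathPartition : Digraph n → Set
  HasLeafPathPartition A = ∃ (IsLeafPathPartition A)

  HasLeafInducedPathPartition : Digraph n → Set
  HasLeafInducedPathPartition A = ∃ (IsLeafInducedPathPartition A)

{-# OPTIONS --safe #-}
-- A leaf path partition gives a forest: keep the arcs between consecutive vertices of
-- each path.  Its trees are the paths, rooted at their first vertices, and since the
-- last vertex of a path is a leaf of N while every other vertex keeps its successor,
-- its leaves are those of N.  If the paths are induced, an arc of N inside a path
-- joins consecutive vertices (other backward or forward arcs would close a cycle or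
-- be chords), so every remaining arc runs between trees.
--
-- Conversely, in a spanning forest with the leaves of N every non-leaf has a child
-- and every vertex at most one parent.  Starting from singletons, treat the vertices
-- one at a time, appending to the path that ends at v the path that contains a child
-- w of v; that path starts at w, as v is its only parent.  The final paths follow
-- forest arcs and end at leaves.  If N is forest-based, a chord of such a path lies
-- inside one tree, so it is a forest arc, and its head would have two parents.

module Submission where

open import Defs
open import Data.Nat as ℕ using (ℕ; suc; _+_; _≤_; _<_; z≤n; s≤s)
import Data.Nat.Properties as ℕ
open import Data.Fin using (Fin; zero; suc; toℕ; _≟_)
open import Data.Fin.Properties using (toℕ<n; any?)
open import Data.List
  using (List; []; _∷_; _++_; concat; map; length; lookup; allFin; initLast; _∷ʳ′_)
open import Data.List.Properties using (++-assoc; map-∘; concat-map-[_])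
open import Data.List.NonEmpty as List⁺ using (List⁺; toList; last; _⁺++⁺_) renaming (_∷_ to _∷⁺_)
open import Data.List.Relation.Unary.All as All using (All; []; _∷_)
import Data.List.Relation.Unary.All.Properties as All
open import Data.List.Relation.Unary.Any as Any using (Any; here; there)
open import Data.List.Relation.Unary.Any.Properties using (lookup-index)
open import Data.List.Relation.Unary.AllPairs using ([]; _∷_)
open import Data.List.Relation.Unary.Unique.Propositional using (Unique)
open import Data.List.Relation.Unary.Unique.Propositional.Properties
  using (allFin⁺; Unique[x∷xs]⇒x∉xs)
open import Data.List.Relation.Unary.Linked as Linked using (Linked; []; [-]; _∷_)
open import Data.List.Relation.Binary.Permutation.Propositional as ↭
  using (_↭_; ↭-refl; ↭-sym; ↭-trans; ↭-reflexive; ↭⇒↭ₛ)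
open import Data.List.Relation.Binary.Permutation.Propositional.Properties
  using (∈-resp-↭; All-resp-↭; shift; shifts; ++⁺ˡ)
import Data.List.Relation.Binary.Permutation.Setoid.Properties as Permutationₛ
open import Data.List.Membership.Propositional using (_∈_; _∉_; find; lose)
open import Data.List.Membership.Propositional.Properties
  using ( ∈-lookup; ∈-++⁺ˡ; ∈-++⁺ʳ; ∈-++⁻; ∈-allFin; ∈-map⁺; ∈-map⁻
        ; ∈-concat⁺′; ∈-concat⁻′; ∈-∃++)
open import Data.Product using (∃; ∃₂; _×_; _,_; proj₁; proj₂; map₂)
open import Data.Sum using (_⊎_; inj₁; inj₂)
open import Data.Empty using (⊥-elim)
open import Function using (_∘_)
open import Function.Bundles using (_⇔_; mk⇔; Equivalence)
open import Relation.Nullary using (¬_; Dec; yes; no)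
open import Relation.Nullary.Decidable
  using (isYes; toWitness; fromWitness; T?; decidable-stable; map′; _×-dec_; _⊎-dec_)
open import Relation.Binary.Definitions using (DecidableEquality)
open import Relation.Binary.PropositionalEquality as ≡
  using (_≡_; refl; sym; trans; cong; subst; subst₂)
open import Relation.Binary.Construct.Closure.Transitive using (TransClosure; [_]; _∷_)
open import Relation.Binary.Construct.Closure.ReflexiveTransitive as Star using (Star; ε; _◅_)

module _ {X : Set} where

  data Consecutive : List X → X → X → Set where
    here  : ∀ {u v xs} → Consecutive (u ∷ v ∷ xs) u v
    there : ∀ {x u v xs} → Consecutive xs u v → Consecutive (x ∷ xs) u v

  consecutive? : DecidableEquality X → ∀ xs u v → Dec (Consecutive xs u v)
  consecutive? _≟ₓ_ []           u v = no λ ()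
  consecutive? _≟ₓ_ (x ∷ [])     u v = no λ { (there ()) }
  consecutive? _≟ₓ_ (x ∷ y ∷ xs) u v =
    map′ (λ { (inj₁ (refl , refl)) → here ; (inj₂ c) → there c })
         (λ { here → inj₁ (refl , refl) ; (there c) → inj₂ c })
         ((x ≟ₓ u ×-dec y ≟ₓ v) ⊎-dec consecutive? _≟ₓ_ (y ∷ xs) u v)

  Consecutive⇒∈ˡ : ∀ {xs u v} → Consecutive xs u v → u ∈ xs
  Consecutive⇒∈ˡ here      = here refl
  Consecutive⇒∈ˡ (there c) = there (Consecutive⇒∈ˡ c)

  Consecutive⇒∈ʳ : ∀ {xs u v} → Consecutive xs u v → v ∈ xs
  Consecutive⇒∈ʳ here      = there (here refl)
  Consecutive⇒∈ʳ (there c) = there (Consecutive⇒∈ʳ c)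

  Consecutive⇒∈tail : ∀ {x xs u v} → Consecutive (x ∷ xs) u v → v ∈ xs
  Consecutive⇒∈tail here      = here refl
  Consecutive⇒∈tail (there c) = Consecutive⇒∈ʳ c

  Consecutive-injective : ∀ {xs u w v} → Unique xs →
                          Consecutive xs u v → Consecutive xs w v → u ≡ w
  Consecutive-injective _                  here      here       = refl
  Consecutive-injective (_ ∷ tail-unique)  here      (there c)  =
    ⊥-elim (Unique[x∷xs]⇒x∉xs tail-unique (Consecutive⇒∈tail c))
  Consecutive-injective (_ ∷ tail-unique)  (there c) here       =
    ⊥-elim (Unique[x∷xs]⇒x∉xs tail-unique (Consecutive⇒∈tail c))
  Consecutive-injective (_ ∷ tail-unique)  (there c) (there c′) =
    Consecutive-injective tail-unique c c′

  ∈-tail⇒Consecutive : ∀ {h t x} → x ∈ t → ∃ λ u → Consecutive (h ∷ t) u x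
  ∈-tail⇒Consecutive (here refl) = _ , here
  ∈-tail⇒Consecutive (there x∈t) with u , c ← ∈-tail⇒Consecutive x∈t = u , there c

  ∈⇒head⊎Consecutive : ∀ {h t x} → x ∈ h ∷ t →
                       x ≡ h ⊎ ∃ λ u → Consecutive (h ∷ t) u x
  ∈⇒head⊎Consecutive (here x≡h)  = inj₁ x≡h
  ∈⇒head⊎Consecutive (there x∈t) = inj₂ (∈-tail⇒Consecutive x∈t)

  lookup-Consecutive : ∀ xs (i j : Fin (length xs)) → toℕ j ≡ suc (toℕ i) →
                       Consecutive xs (lookup xs i) (lookup xs j)
  lookup-Consecutive (x ∷ y ∷ xs) zero    (suc zero) _ = here
  lookup-Consecutive (x ∷ xs)     (suc i) (suc j)        j≡1+i =
    there (lookup-Consecutive xs i j (ℕ.suc-injective j≡1+i))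

  last-∷ : ∀ (x y : X) ys → last (x ∷⁺ y ∷ ys) ≡ last (y ∷⁺ ys)
  last-∷ x y ys with initLast ys
  ... | []       = refl
  ... | _ ∷ʳ′ _ = refl

  last-∈ : ∀ p → last p ∈ toList p
  last-∈ (h ∷⁺ t) = go h t
    where
    go : ∀ h t → last (h ∷⁺ t) ∈ h ∷ t
    go h []       = here refl
    go h (y ∷ ys) rewrite last-∷ h y ys = there (go y ys)

  last-⁺++⁺ : ∀ p q → last (p ⁺++⁺ q) ≡ last q
  last-⁺++⁺ (h ∷⁺ t) q = go h t
    where
    go : ∀ h t → last ((h ∷⁺ t) ⁺++⁺ q) ≡ last q
    go h []       = last-∷ h (List⁺.head q) (List⁺.tail q)
    go h (y ∷ ys) = trans (last-∷ h y (ys ++ toList q)) (go y ys)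

  ∈⇒last⊎Consecutive : ∀ p {x} → x ∈ toList p →
                       x ≡ last p ⊎ ∃ λ w → Consecutive (toList p) x w
  ∈⇒last⊎Consecutive (h ∷⁺ [])     (here x≡h)  = inj₁ x≡h
  ∈⇒last⊎Consecutive (h ∷⁺ y ∷ ys) (here refl) = inj₂ (y , here)
  ∈⇒last⊎Consecutive (h ∷⁺ y ∷ ys) (there x∈)
    with ∈⇒last⊎Consecutive (y ∷⁺ ys) x∈
  ... | inj₁ x≡last  = inj₁ (trans x≡last (sym (last-∷ h y ys)))
  ... | inj₂ (w , c) = inj₂ (w , there c)

module _ {X : Set} {R : X → X → Set} where

  Linked-consecutive : ∀ {xs u v} → Linked R xs → Consecutive xs u v → R u v
  Linked-consecutive (r ∷ _)  here      = r
  Linked-consecutive (_ ∷ rs) (there c) = Linked-consecutive rs c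

  consecutive⇒Linked : ∀ xs → (∀ {u v} → Consecutive xs u v → R u v) → Linked R xs
  consecutive⇒Linked []           _ = []
  consecutive⇒Linked (x ∷ [])     _ = [-]
  consecutive⇒Linked (x ∷ y ∷ xs) r = r here ∷ consecutive⇒Linked (y ∷ xs) (r ∘ there)

  Linked-⁺++⁺ : ∀ p q → Linked R (toList p) → R (last p) (List⁺.head q) →
                Linked R (toList q) → Linked R (toList (p ⁺++⁺ q))
  Linked-⁺++⁺ (x ∷⁺ [])     _ _        r rq = r ∷ rq
  Linked-⁺++⁺ (x ∷⁺ y ∷ ys) q (r₀ ∷ rp) r rq =
    r₀ ∷ Linked-⁺++⁺ (y ∷⁺ ys) q rp (subst (λ z → R z _) (last-∷ x y ys) r) rq

  Linked⇒Star-head : ∀ {h t x} → Linked R (h ∷ t) → x ∈ h ∷ t → Star R h x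
  Linked⇒Star-head _        (here refl)  = ε
  Linked⇒Star-head (r ∷ rs) (there x∈)   = r ◅ Linked⇒Star-head rs x∈

  Linked⇒Star-last : ∀ p {x} → Linked R (toList p) → x ∈ toList p → Star R x (last p)
  Linked⇒Star-last (h ∷⁺ [])     _        (here refl) = ε
  Linked⇒Star-last (h ∷⁺ y ∷ ys) (r ∷ rs) x∈          =
    subst (Star R _) (sym (last-∷ h y ys)) (to-last x∈)
    where
    to-last : ∀ {x} → x ∈ h ∷ y ∷ ys → Star R x (last (y ∷⁺ ys))
    to-last (here refl) = r ◅ Linked⇒Star-last (y ∷⁺ ys) rs (here refl)
    to-last (there x∈′) = Linked⇒Star-last (y ∷⁺ ys) rs x∈′

  Linked⇒Star-lookup : ∀ {xs} → Linked R xs → (i j : Fin (length xs)) → toℕ i ≤ toℕ j →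
                       Star R (lookup xs i) (lookup xs j)
  Linked⇒Star-lookup [-]      zero    zero    _         = ε
  Linked⇒Star-lookup (_ ∷ _)  zero    zero    _         = ε
  Linked⇒Star-lookup (r ∷ rs) zero    (suc j) _         = r ◅ Linked⇒Star-lookup rs zero j z≤n
  Linked⇒Star-lookup (_ ∷ rs) (suc i) (suc j) (s≤s i≤j) = Linked⇒Star-lookup rs i j i≤j

module _ {X : Set} {R S : X → X → Set} where

  TransClosure-map : (∀ {x y} → R x y → S x y) →
                     ∀ {x y} → TransClosure R x y → TransClosure S x y
  TransClosure-map f [ r ]    = [ f r ]
  TransClosure-map f (r ∷ rs) = f r ∷ TransClosure-map f rs

module _ {X : Set} {R : X → X → Set} where

  infixr 5 _◅⁺_

  _◅⁺_ : ∀ {x y z} → R x y → Star R y z → TransClosure R x z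
  r ◅⁺ ε        = [ r ]
  r ◅⁺ (s ◅ ss) = r ∷ (s ◅⁺ ss)

module _ {X : Set} where

  cat : List (List⁺ X) → List X
  cat P = concat (map toList P)

  ∈-cat⁺ : ∀ {P p x} → p ∈ P → x ∈ toList p → x ∈ cat P
  ∈-cat⁺ p∈P x∈p = ∈-concat⁺′ x∈p (∈-map⁺ toList p∈P)

  ∈-cat⁻ : ∀ P {x} → x ∈ cat P → ∃ λ p → p ∈ P × x ∈ toList p
  ∈-cat⁻ P x∈ with xs , x∈xs , xs∈ ← ∈-concat⁻′ (map toList P) x∈
              with p , p∈P , refl ← ∈-map⁻ toList xs∈ = p , p∈P , x∈xs

  cat-↭ : ∀ {P Q} → P ↭ Q → cat P ↭ cat Q
  cat-↭ ↭.refl         = ↭-refl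
  cat-↭ (↭.prep p σ)   = ++⁺ˡ (toList p) (cat-↭ σ)
  cat-↭ (↭.swap p q σ) =
    ↭-trans (shifts (toList p) (toList q)) (++⁺ˡ (toList q) (++⁺ˡ (toList p) (cat-↭ σ)))
  cat-↭ (↭.trans σ τ)  = ↭-trans (cat-↭ σ) (cat-↭ τ)

  ∈-cat⇒↭ : ∀ P {x} → x ∈ cat P → ∃₂ λ p R → x ∈ toList p × P ↭ p ∷ R
  ∈-cat⇒↭ P x∈ with p , p∈P , x∈p ← ∈-cat⁻ P x∈
               with P₁ , P₂ , refl ← ∈-∃++ p∈P = p , P₁ ++ P₂ , x∈p , shift p P₁ P₂

  cat-singletons : ∀ (xs : List X) → cat (map List⁺.[_] xs) ≡ xs
  cat-singletons xs = trans (cong concat (sym (map-∘ xs))) (concat-map-[ xs ])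

  Unique-++⁻ˡ : ∀ (xs : List X) {ys} → Unique (xs ++ ys) → Unique xs
  Unique-++⁻ˡ []       _            = []
  Unique-++⁻ˡ (x ∷ xs) (x∉ ∷ uniq) = All.++⁻ˡ xs x∉ ∷ Unique-++⁻ˡ xs uniq

  Unique-++⁻ʳ : ∀ (xs : List X) {ys} → Unique (xs ++ ys) → Unique ys
  Unique-++⁻ʳ []       uniq       = uniq
  Unique-++⁻ʳ (x ∷ xs) (_ ∷ uniq) = Unique-++⁻ʳ xs uniq

  Unique-++⇒∉ : ∀ (xs : List X) {ys x} → Unique (xs ++ ys) → x ∈ xs → x ∉ ys
  Unique-++⇒∉ (x ∷ xs) (x∉ ∷ _)   (here refl) x∈ys = All.lookup (All.++⁻ʳ xs x∉) x∈ys refl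
  Unique-++⇒∉ (_ ∷ xs) (_ ∷ uniq) (there x∈)       = Unique-++⇒∉ xs uniq x∈

  Unique-cat⇒Unique : ∀ {P p} → Unique (cat P) → p ∈ P → Unique (toList p)
  Unique-cat⇒Unique {q ∷ P} uniq (here refl) = Unique-++⁻ˡ (toList q) uniq
  Unique-cat⇒Unique {q ∷ P} uniq (there p∈P) =
    Unique-cat⇒Unique (Unique-++⁻ʳ (toList q) uniq) p∈P

  Unique-cat⇒≡ : ∀ {P p q x} → Unique (cat P) → p ∈ P → q ∈ P →
                 x ∈ toList p → x ∈ toList q → p ≡ q
  Unique-cat⇒≡ {r ∷ P} _    (here refl) (here refl) _   _   = refl
  Unique-cat⇒≡ {r ∷ P} uniq (here refl) (there q∈P) x∈p x∈q =
    ⊥-elim (Unique-++⇒∉ (toList r) uniq x∈p (∈-cat⁺ q∈P x∈q))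
  Unique-cat⇒≡ {r ∷ P} uniq (there p∈P) (here refl) x∈p x∈q =
    ⊥-elim (Unique-++⇒∉ (toList r) uniq x∈q (∈-cat⁺ p∈P x∈p))
  Unique-cat⇒≡ {r ∷ P} uniq (there p∈P) (there q∈P) x∈p x∈q =
    Unique-cat⇒≡ (Unique-++⁻ʳ (toList r) uniq) p∈P q∈P x∈p x∈q

module _ {n : ℕ} where

  ↭-allFin⇒Unique : ∀ {xs} → xs ↭ allFin n → Unique xs
  ↭-allFin⇒Unique σ =
    Permutationₛ.Unique-resp-↭ (≡.setoid (Fin n)) (↭⇒↭ₛ (↭-sym σ)) (allFin⁺ n)

  ↭-allFin⇒∈ : ∀ {xs} → xs ↭ allFin n → ∀ v → v ∈ xs
  ↭-allFin⇒∈ σ v = ∈-resp-↭ (↭-sym σ) (∈-allFin v)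

  InDegree≤1 : Digraph n → Set
  InDegree≤1 F = ∀ u w v → Arc F u v → Arc F w v → u ≡ w

  ExtraArcsBetweenTrees : Digraph n → Digraph n → Set
  ExtraArcsBetweenTrees A F = ∀ u v → Arc A u v → ¬ Arc F u v → ¬ Connected F u v

  successor? : ∀ (F : Digraph n) v → Dec (∃ (Arc F v))
  successor? F v = any? (λ w → T? (F v w))

  SubArcs⇒Acyclic : ∀ {F A : Digraph n} → SubArcs F A → Acyclic A → Acyclic F
  SubArcs⇒Acyclic F⊆A acyclic v cycle = acyclic v (TransClosure-map (F⊆A _ _) cycle)

  no-cycle : ∀ {A : Digraph n} {u v} → Acyclic A → Arc A u v → ¬ Star (Arc A) v u
  no-cycle acyclic a back = acyclic _ (a ◅⁺ back)

  dirPath-arc⇒< : ∀ {A : Digraph n} {xs} → Acyclic A → Linked (Arc A) xs → ∀ i j →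
                  Arc A (lookup xs i) (lookup xs j) → toℕ i < toℕ j
  dirPath-arc⇒< acyclic path i j a with toℕ i ℕ.<? toℕ j
  ... | yes i<j = i<j
  ... | no  i≮j = ⊥-elim (no-cycle acyclic a (Linked⇒Star-lookup path j i (ℕ.≮⇒≥ i≮j)))

  inducedPath-arc⇒suc : ∀ {A : Digraph n} p → Acyclic A → IsDirPath A p → IsInduced A p →
                        ∀ i j → Arc A (lookup (toList p) i) (lookup (toList p) j) →
                        toℕ j ≡ suc (toℕ i)
  inducedPath-arc⇒suc p acyclic path induced i j a with toℕ j ℕ.≟ suc (toℕ i)
  ... | yes j≡1+i = j≡1+i
  ... | no  j≢1+i = ⊥-elim (induced i j room (ℕ.<⇒≢ i<j ∘ sym) j≢1+i a)
    where
    i<j : toℕ i < toℕ j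
    i<j = dirPath-arc⇒< acyclic path i j a
    room : toℕ i + 3 ≤ length (toList p)
    room = subst (_≤ length (toList p)) (ℕ.+-comm 3 (toℕ i))
                 (ℕ.≤-trans (s≤s (ℕ.≤∧≢⇒< i<j (j≢1+i ∘ sym))) (toℕ<n j))

  inducedPath-arc⇒Consecutive : ∀ {A : Digraph n} p {u v} →
                                Acyclic A → IsDirPath A p → IsInduced A p →
                                u ∈ toList p → v ∈ toList p → Arc A u v →
                                Consecutive (toList p) u v
  inducedPath-arc⇒Consecutive {A} p acyclic path induced u∈ v∈ a =
    subst₂ (Consecutive (toList p)) (sym (lookup-index u∈)) (sym (lookup-index v∈))
      (lookup-Consecutive (toList p) i j
        (inducedPath-arc⇒suc p acyclic path induced i j
          (subst₂ (Arc A) (lookup-index u∈) (lookup-index v∈) a)))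
    where
    i j : Fin (length (toList p))
    i = Any.index u∈
    j = Any.index v∈

  shortcut-free : ∀ {F : Digraph n} {xs} → InDegree≤1 F → Unique xs → Linked (Arc F) xs →
                  ∀ i j → suc (toℕ i) < toℕ j → ¬ Arc F (lookup xs i) (lookup xs j)
  shortcut-free {xs = x ∷ y ∷ ys} inDegree≤1 uniq (_ ∷ path) zero (suc (suc k)) _ x→z
    with w , c ← ∈-tail⇒Consecutive {h = y} (∈-lookup {xs = ys} k)
    with refl ← inDegree≤1 x w _ x→z (Linked-consecutive path c)
    = Unique[x∷xs]⇒x∉xs uniq (Consecutive⇒∈ˡ c)
  shortcut-free _ _ (_ ∷ _) zero (suc zero) (s≤s ())
  shortcut-free inDegree≤1 (_ ∷ uniq) (_ ∷ path) (suc i) (suc j) (s≤s 1+i<j) =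
    shortcut-free inDegree≤1 uniq path i j 1+i<j

  forestPath⇒Induced : ∀ {A F : Digraph n} → Acyclic A → SubArcs F A → InDegree≤1 F →
                       ExtraArcsBetweenTrees A F →
                       ∀ p → Unique (toList p) → Linked (Arc F) (toList p) → IsInduced A p
  forestPath⇒Induced {F = F} acyclic F⊆A inDegree≤1 extra p uniq path i j _ _ j≢1+i a =
    shortcut-free inDegree≤1 uniq path i j (ℕ.≤∧≢⇒< i<j (j≢1+i ∘ sym)) forest-arc
    where
    i<j : toℕ i < toℕ j
    i<j = dirPath-arc⇒< acyclic (Linked.map (λ {u} {v} → F⊆A u v) path) i j a
    forest-arc : Arc F (lookup (toList p) i) (lookup (toList p) j)
    forest-arc = decidable-stable (T? _) λ ¬forest-arc →
      extra _ _ a ¬forest-arc (Star.map inj₁ (Linked⇒Star-lookup path i j (ℕ.<⇒≤ i<j)))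

pathForest : ∀ {n} → List (List⁺ (Fin n)) → Digraph n
pathForest P u v = isYes (Any.any? (λ p → consecutive? _≟_ (toList p) u v) P)

module PathForest {n} {A : Digraph n} (acyclic : Acyclic A) {P : List (List⁺ (Fin n))}
                  (paths : All (IsDirPath A) P) (covers : cat P ↭ allFin n)
                  (ends : All (λ p → IsLeaf A (last p)) P) where

  private
    F : Digraph n
    F = pathForest P

    unique : Unique (cat P)
    unique = ↭-allFin⇒Unique covers

  arc⁺ : ∀ {p u v} → p ∈ P → Consecutive (toList p) u v → Arc F u v
  arc⁺ p∈P c = fromWitness (lose p∈P c)

  arc⁻ : ∀ {u v} → Arc F u v → ∃ λ p → p ∈ P × Consecutive (toList p) u v
  arc⁻ a = find (toWitness a)

  pathForest-Linked : ∀ {p} → p ∈ P → Linked (Arc F) (toList p)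
  pathForest-Linked {p} p∈P = consecutive⇒Linked (toList p) (arc⁺ p∈P)

  pathForest⊆ : SubArcs F A
  pathForest⊆ u v a with p , p∈P , c ← arc⁻ a = Linked-consecutive (All.lookup paths p∈P) c

  inDegree≤1 : InDegree≤1 F
  inDegree≤1 u w v a b
    with p , p∈P , c ← arc⁻ a | q , q∈P , c′ ← arc⁻ b
    with refl ← Unique-cat⇒≡ unique p∈P q∈P (Consecutive⇒∈ʳ c) (Consecutive⇒∈ʳ c′)
    = Consecutive-injective (Unique-cat⇒Unique unique p∈P) c c′

  head-isRoot : ∀ {h t} → h ∷⁺ t ∈ P → IsRoot F h
  head-isRoot p∈P u a
    with q , q∈P , c ← arc⁻ a
    with refl ← Unique-cat⇒≡ unique p∈P q∈P (here refl) (Consecutive⇒∈ʳ c)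
    = Unique[x∷xs]⇒x∉xs (Unique-cat⇒Unique unique p∈P) (Consecutive⇒∈tail c)

  root⇒head : ∀ {r h t} → IsRoot F r → h ∷⁺ t ∈ P → r ∈ h ∷ t → r ≡ h
  root⇒head root p∈P r∈ with ∈⇒head⊎Consecutive r∈
  ... | inj₁ r≡h     = r≡h
  ... | inj₂ (u , c) = ⊥-elim (root u (arc⁺ p∈P c))

  SamePath : Fin n → Fin n → Set
  SamePath u v = ∃ λ p → p ∈ P × u ∈ toList p × v ∈ toList p

  SamePath-refl : ∀ v → SamePath v v
  SamePath-refl v with p , p∈P , v∈p ← ∈-cat⁻ P (↭-allFin⇒∈ covers v) =
    p , p∈P , v∈p , v∈p

  SamePath-trans : ∀ {u v w} → SamePath u v → SamePath v w → SamePath u w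
  SamePath-trans (p , p∈P , u∈p , v∈p) (q , q∈P , v∈q , w∈q)
    with refl ← Unique-cat⇒≡ unique p∈P q∈P v∈p v∈q = p , p∈P , u∈p , w∈q

  edge⇒SamePath : ∀ {u v} → Arc F u v ⊎ Arc F v u → SamePath u v
  edge⇒SamePath (inj₁ a) with p , p∈P , c ← arc⁻ a =
    p , p∈P , Consecutive⇒∈ˡ c , Consecutive⇒∈ʳ c
  edge⇒SamePath (inj₂ a) with p , p∈P , c ← arc⁻ a =
    p , p∈P , Consecutive⇒∈ʳ c , Consecutive⇒∈ˡ c

  Connected⇒SamePath : ∀ {u v} → Connected F u v → SamePath u v
  Connected⇒SamePath ε          = SamePath-refl _
  Connected⇒SamePath (e ◅ conn) = SamePath-trans (edge⇒SamePath e) (Connected⇒SamePath conn)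

  hasRoot : ∀ v → ∃ λ r → IsRoot F r × Connected F v r
  hasRoot v with h ∷⁺ t , p∈P , v∈p ← ∈-cat⁻ P (↭-allFin⇒∈ covers v) =
    h , head-isRoot p∈P , Star.reverse inj₂ (Linked⇒Star-head (pathForest-Linked p∈P) v∈p)

  connectedRoots⇒≡ : ∀ r r′ → IsRoot F r → IsRoot F r′ → Connected F r r′ → r ≡ r′
  connectedRoots⇒≡ r r′ root root′ conn
    with h ∷⁺ t , p∈P , r∈p , r′∈p ← Connected⇒SamePath conn =
    trans (root⇒head root p∈P r∈p) (sym (root⇒head root′ p∈P r′∈p))

  isForest : IsForest F
  isForest = SubArcs⇒Acyclic pathForest⊆ acyclic , inDegree≤1 , hasRoot , connectedRoots⇒≡

  sameLeaves : SameLeaves F A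
  sameLeaves v = mk⇔ leafF⇒leafA (λ leafA w → leafA w ∘ pathForest⊆ v w)
    where
    leafF⇒leafA : IsLeaf F v → IsLeaf A v
    leafF⇒leafA leafF
      with p , p∈P , v∈p ← ∈-cat⁻ P (↭-allFin⇒∈ covers v)
      with ∈⇒last⊎Consecutive p v∈p
    ... | inj₁ v≡last  = subst (IsLeaf A) (sym v≡last) (All.lookup ends p∈P)
    ... | inj₂ (w , c) = ⊥-elim (leafF w (arc⁺ p∈P c))

  spanningLeafForest : SpanningLeafForest A F
  spanningLeafForest = pathForest⊆ , isForest , sameLeaves

  extraArcsBetweenTrees : All (IsInduced A) P → ExtraArcsBetweenTrees A F
  extraArcsBetweenTrees induced u v a ¬forest-arc conn
    with p , p∈P , u∈p , v∈p ← Connected⇒SamePath conn =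
    ¬forest-arc (arc⁺ p∈P (inducedPath-arc⇒Consecutive p acyclic
                             (All.lookup paths p∈P) (All.lookup induced p∈P) u∈p v∈p a))

module ForestPaths {n} {F : Digraph n} (acyclic : Acyclic F) (inDegree≤1 : InDegree≤1 F) where

  -- T lists the vertices not processed yet.  Paths only use arcs leaving processed
  -- vertices, so an unprocessed vertex is last on its path; a path may end at a
  -- non-leaf only while that vertex is unprocessed.
  Step : List (Fin n) → Fin n → Fin n → Set
  Step T u v = Arc F u v × u ∉ T

  MayEnd : List (Fin n) → Fin n → Set
  MayEnd T x = x ∈ T ⊎ IsLeaf F x

  Valid : List (Fin n) → List⁺ (Fin n) → Set
  Valid T p = Linked (Step T) (toList p) × MayEnd T (last p)

  Partial : List (Fin n) → List (List⁺ (Fin n)) → Set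
  Partial T P = cat P ↭ allFin n × All (Valid T) P

  Partial-↭ : ∀ {T P Q} → P ↭ Q → Partial T P → Partial T Q
  Partial-↭ σ (covers , valid) = ↭-trans (cat-↭ (↭-sym σ)) covers , All-resp-↭ σ valid

  narrowSteps : ∀ {v T xs} → Linked (Step (v ∷ T)) xs → Linked (Step T) xs
  narrowSteps = Linked.map λ (a , u∉) → a , u∉ ∘ there

  narrowEnd : ∀ {v T x} → (x ≡ v → IsLeaf F v) → MayEnd (v ∷ T) x → MayEnd T x
  narrowEnd end-ok (inj₁ (here x≡v))  = inj₂ (subst (IsLeaf F) (sym x≡v) (end-ok x≡v))
  narrowEnd _      (inj₁ (there x∈T)) = inj₁ x∈T
  narrowEnd _      (inj₂ leaf)        = inj₂ leaf

  narrow : ∀ {v T p} → (last p ≡ v → IsLeaf F v) → Valid (v ∷ T) p → Valid T p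
  narrow end-ok (steps , mayEnd) = narrowSteps steps , narrowEnd end-ok mayEnd

  unprocessed⇒last : ∀ {v T p} → Valid (v ∷ T) p → v ∈ toList p → v ≡ last p
  unprocessed⇒last {p = p} (steps , _) v∈p with ∈⇒last⊎Consecutive p v∈p
  ... | inj₁ v≡last  = v≡last
  ... | inj₂ (_ , c) = ⊥-elim (proj₂ (Linked-consecutive steps c) (here refl))

  child⇒head : ∀ {v w T q} → Valid (v ∷ T) q → Arc F v w → w ∈ toList q → w ≡ List⁺.head q
  child⇒head (steps , _) v→w w∈q with ∈⇒head⊎Consecutive w∈q
  ... | inj₁ w≡head  = w≡head
  ... | inj₂ (u , c) with u→w , u∉ ← Linked-consecutive steps c =
    ⊥-elim (u∉ (here (inDegree≤1 _ _ _ u→w v→w)))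

  child∉ : ∀ {v w T p} → Valid (v ∷ T) p → v ∈ toList p → Arc F v w → w ∉ toList p
  child∉ {p = p} valid@(steps , _) v∈p v→w w∈p =
    no-cycle acyclic v→w (subst (Star (Arc F) _) (sym (unprocessed⇒last valid v∈p))
                                (Linked⇒Star-last p (Linked.map proj₁ steps) w∈p))

  join : ∀ {v w T p q R} → v ∉ T → Arc F v w → v ∈ toList p → w ∈ toList q →
         Partial (v ∷ T) (p ∷ q ∷ R) → Partial T ((p ⁺++⁺ q) ∷ R)
  join {v} {w} {T} {p} {q} {R} v∉T v→w v∈p w∈q (covers , valid-p ∷ valid-q ∷ valid-R) =
    ↭-trans (↭-reflexive (++-assoc (toList p) (toList q) (cat R))) covers ,
    (joined-steps , joined-end) ∷
    All.tabulate (λ r∈R → narrow (ends-elsewhere r∈R) (All.lookup valid-R r∈R))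
    where
    v∉qR : v ∉ toList q ++ cat R
    v∉qR = Unique-++⇒∉ (toList p) (↭-allFin⇒Unique covers) v∈p

    ends-elsewhere : ∀ {r} → r ∈ R → last r ≡ v → IsLeaf F v
    ends-elsewhere {r} r∈R e =
      ⊥-elim (v∉qR (∈-++⁺ʳ (toList q) (∈-cat⁺ r∈R (subst (_∈ toList r) e (last-∈ r)))))

    junction : Step T (last p) (List⁺.head q)
    junction =
      subst₂ (Step T) (unprocessed⇒last valid-p v∈p) (child⇒head valid-q v→w w∈q) (v→w , v∉T)

    joined-steps : Linked (Step T) (toList (p ⁺++⁺ q))
    joined-steps =
      Linked-⁺++⁺ p q (narrowSteps (proj₁ valid-p)) junction (narrowSteps (proj₁ valid-q))

    joined-end : MayEnd T (last (p ⁺++⁺ q))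
    joined-end = subst (MayEnd T) (sym (last-⁺++⁺ p q))
      (narrowEnd (λ e → ⊥-elim (v∉qR (∈-++⁺ˡ (subst (_∈ toList q) e (last-∈ q)))))
                 (proj₂ valid-q))

  extend : ∀ {v w T p R} → v ∉ T → Arc F v w → v ∈ toList p →
           Partial (v ∷ T) (p ∷ R) → ∃ (Partial T)
  extend {w = w} {p = p} {R} v∉T v→w v∈p inv@(covers , valid-p ∷ _)
    with ∈-++⁻ (toList p) (↭-allFin⇒∈ covers w)
  ... | inj₁ w∈p = ⊥-elim (child∉ valid-p v∈p v→w w∈p)
  ... | inj₂ w∈R with q , R′ , w∈q , R↭qR′ ← ∈-cat⇒↭ R w∈R =
    (p ⁺++⁺ q) ∷ R′ , join v∉T v→w v∈p w∈q (Partial-↭ (↭.prep p R↭qR′) inv)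

  process : ∀ {v T} → v ∉ T → ∀ P → Partial (v ∷ T) P → ∃ (Partial T)
  process {v} v∉T P inv@(covers , valid) with successor? F v
  ... | no ¬succ = P , covers , All.map (narrow λ _ w v→w → ¬succ (w , v→w)) valid
  ... | yes (_ , v→w) with p , R , v∈p , P↭pR ← ∈-cat⇒↭ P (↭-allFin⇒∈ covers v) =
    extend v∉T v→w v∈p (Partial-↭ P↭pR inv)

  processAll : ∀ T → Unique T → ∀ P → Partial T P → ∃ (Partial [])
  processAll []      _                      P inv = P , inv
  processAll (v ∷ T) uniq@(_ ∷ T-unique)  P inv
    with P′ , inv′ ← process (Unique[x∷xs]⇒x∉xs uniq) P inv =
    processAll T T-unique P′ inv′

  start : Partial (allFin n) (map List⁺.[_] (allFin n))
  start = ↭-reflexive (cat-singletons (allFin n)) ,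
          All.map⁺ (All.universal (λ v → [-] , inj₁ (∈-allFin v)) (allFin n))

  finish : ∀ {P} → Partial [] P → IsLeafPathPartition F P
  finish (covers , valid) =
    (All.map (Linked.map proj₁ ∘ proj₁) valid , covers) , All.map ended valid
    where
    ended : ∀ {p} → Valid [] p → IsLeaf F (last p)
    ended (_ , inj₂ leaf) = leaf

  leafPathPartition : HasLeafPathPartition F
  leafPathPartition with P , inv ← processAll (allFin n) (allFin⁺ n) _ start = P , finish inv

module _ {n : ℕ} {A : Digraph n} where

  liftLeafPathPartition : ∀ {F P} → SubArcs F A → SameLeaves F A →
                          IsLeafPathPartition F P → IsLeafPathPartition A P
  liftLeafPathPartition F⊆A sameLeaves ((paths , covers) , ends) =
    (All.map (Linked.map λ {u} {v} → F⊆A u v) paths , covers) ,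
    All.map (Equivalence.to (sameLeaves _)) ends

  forestPathPartition⇒Induced : ∀ {F P} → Acyclic A → SubArcs F A → InDegree≤1 F →
                                ExtraArcsBetweenTrees A F →
                                IsLeafPathPartition F P → All (IsInduced A) P
  forestPathPartition⇒Induced acyclic F⊆A inDegree≤1 extra ((paths , covers) , _) =
    All.tabulate λ {p} p∈P →
      forestPath⇒Induced acyclic F⊆A inDegree≤1 extra p
        (Unique-cat⇒Unique (↭-allFin⇒Unique covers) p∈P) (All.lookup paths p∈P)

  weaklyForestBased⇒leafPathPartition : WeaklyForestBased A → HasLeafPathPartition A
  weaklyForestBased⇒leafPathPartition (F , F⊆A , (acyclicF , inDegree≤1 , _) , sameLeaves) =
    map₂ (liftLeafPathPartition F⊆A sameLeaves)
         (ForestPaths.leafPathPartition acyclicF inDegree≤1)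

  leafPathPartition⇒weaklyForestBased : Acyclic A → HasLeafPathPartition A → WeaklyForestBased A
  leafPathPartition⇒weaklyForestBased acyclic (P , (paths , covers) , ends) =
    pathForest P , PathForest.spanningLeafForest acyclic paths covers ends

  forestBased⇒leafInducedPathPartition : Acyclic A → ForestBased A → HasLeafInducedPathPartition A
  forestBased⇒leafInducedPathPartition acyclic
    (F , (F⊆A , (acyclicF , inDegree≤1 , _) , sameLeaves) , extra) =
    map₂ (λ lpp → liftLeafPathPartition F⊆A sameLeaves lpp ,
                  forestPathPartition⇒Induced acyclic F⊆A inDegree≤1 extra lpp)
         (ForestPaths.leafPathPartition acyclicF inDegree≤1)

  leafInducedPathPartition⇒forestBased : Acyclic A → HasLeafInducedPathPartition A → ForestBased A
  leafInducedPathPartition⇒forestBased acyclic (P , ((paths , covers) , ends) , induced) =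
    pathForest P , spanningLeafForest , extraArcsBetweenTrees induced
    where open PathForest acyclic paths covers ends

theorem1 : (n : ℕ) (N : Digraph n) → Acyclic N →
    (WeaklyForestBased N ⇔ HasLeafPathPartition N)
    × (ForestBased N ⇔ HasLeafInducedPathPartition N)
theorem1 n N acyclic =
  mk⇔ weaklyForestBased⇒leafPathPartition (leafPathPartition⇒weaklyForestBased acyclic) ,
  mk⇔ (forestBased⇒leafInducedPathPartition acyclic) (leafInducedPathPartition⇒forestBased acyclic)
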